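{- $c_{15,3}\geq 124928$; that is, there exists a cap set in $AG(15,3)$ with $124928$ points.
   Context: $AG(n,3)$ is identified with $F_3^n$, $F_3=\{0,1,2\}$. A cap set is a set of points of $AG(n,3)$ containing no three distinct points $\alpha,\beta,\gamma$ with $\alpha+\beta+\gamma=\mathbf 0\pmod 3$. $c_{n,3}$ denotes the largest size of a cap set in $AG(n,3)$. -}

module Defs where

open import Data.Fin using (Fin; zero; suc)
open import Data.Vec using (Vec; replicate; zipWith)
open import Data.List using (List; length)
open import Data.List.Membership.Propositional using (_∈_)
open import Data.List.Relation.Unary.Unique.Propositional using (Unique)
open import Data.Nat using (ℕ)
open import Data.Product using (Σ; _×_)
open import Relation.Binary.PropositionalEquality using (_≡_; _≢_)

F₃ : Set
F₃ = Fin 3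

_+₃_ : F₃ → F₃ → F₃
zero +₃ y = y
suc zero +₃ zero = suc zero
suc zero +₃ suc zero = suc (suc zero)
suc zero +₃ suc (suc zero) = zero
suc (suc zero) +₃ zero = suc (suc zero)
suc (suc zero) +₃ suc zero = zero
suc (suc zero) +₃ suc (suc zero) = suc zero

Point : ℕ → Set
Point n = Vec F₃ n

_⊕_ : ∀ {n} → Point n → Point n → Point n
_⊕_ = zipWith _+₃_

𝟎 : ∀ {n} → Point n
𝟎 = replicate _ zero

IsCapSet : ∀ {n} → List (Point n) → Set
IsCapSet {n} S =
  Unique S × (∀ (α β γ : Point n) → α ∈ S → β ∈ S → γ ∈ S →
       α ≢ β → β ≢ γ → α ≢ γ → (α ⊕ β) ⊕ γ ≢ 𝟎)

HasCapSetOfSize : ℕ → ℕ → Set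
HasCapSetOfSize n k = Σ (List (Point n)) (λ S → IsCapSet S × length S ≡ k)

-- The cap is the union of eight blocks H × K × K′ ⊆ F₃³ × F₃⁶ × F₃⁶, where H is the set of
-- points of F₃³ with a prescribed support and K, K′ are two of seven caps in AG(6,3) with 48
-- to 80 points; the block sizes 2^|support| · |K| · |K′| add up to 124928. Each block is a
-- product of caps, hence a cap. For every triple of blocks that are not all equal, the
-- supports or one of the two six-dimensional factors give a triple of sets admitting no zero
-- sum x + y + z = 0 at all, so no zero sum meets two different blocks; for a triple
-- (B, B, B′) this also makes different blocks disjoint, as x + x + x = 0. The finitely many
-- facts about the factors are checked by evaluation, with ternary tries as membership tables.

{-# OPTIONS --safe #-}
module Submission where

open import Data.Bool using (Bool; true; false; T; not; _∨_)
open import Data.Bool.ListAction using (all)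
open import Data.Bool.Properties using (T?)
open import Data.Empty using (⊥-elim)
open import Data.Fin using (Fin; zero; suc; #_; _≟_)
open import Data.Fin.Properties using (all?)
open import Data.Fin.Subset using (Side; Subset; inside; outside)
open import Data.List using (List; []; _∷_; [_]; map; foldr; concatMap; cartesianProductWith; allFin; length)
open import Data.List.Membership.Propositional using (_∈_)
open import Data.List.Membership.Propositional.Properties using (∈-concatMap⁻; ∈-cartesianProductWith⁻)
open import Data.List.Relation.Binary.Disjoint.Propositional using (Disjoint)
open import Data.List.Relation.Unary.All as All using (All; []; _∷_)
open import Data.List.Relation.Unary.All.Properties using (all⁺; concat⁺) renaming (map⁺ to All-map⁺)
open import Data.List.Relation.Unary.AllPairs as AllPairs using ([]; _∷_)
open import Data.List.Relation.Unary.AllPairs.Properties using () renaming (map⁺ to AllPairs-map⁺)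
open import Data.List.Relation.Unary.Any using (here; there; satisfied)
open import Data.List.Relation.Unary.Unique.Propositional using (Unique)
open import Data.List.Relation.Unary.Unique.Propositional.Properties
  using (cartesianProductWith⁺; allFin⁺) renaming (concat⁺ to Unique-concat⁺)
open import Data.Nat using (ℕ; zero; suc; _+_; _/_; _%_)
open import Data.Nat.DivMod using (_mod_)
open import Data.Product using (_×_; _,_; proj₁; proj₂; ∃)
open import Data.Product.Properties using () renaming (≡-dec to ×-≡-dec)
open import Data.Sum using (_⊎_; inj₁; inj₂; [_,_]′) renaming (map₂ to ⊎-map₂)
open import Data.Vec using (Vec; []; _∷_; _++_; _∷ʳ_; lookup; replicate; updateAt)
open import Data.Vec.Properties
  using (∷-injective; ++-injective; zipWith-comm; zipWith-assoc; lookup∘updateAt; lookup∘updateAt′)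
  renaming (≡-dec to Vec-≡-dec)
open import Function using (_∘_)
open import Relation.Binary.Definitions using (DecidableEquality)
open import Relation.Binary.PropositionalEquality using (_≡_; _≢_; refl; sym; trans; cong; cong₂; subst)
open import Relation.Nullary using (¬_; Dec; does; yes; no)
open import Relation.Nullary.Decidable using (toWitness; _×-dec_; _⊎-dec_; _→-dec_)

open import Defs

import Data.List.Membership.DecPropositional as DecMembership
import Data.List.Relation.Unary.Unique.DecPropositional as DecUnique

variable
  m n : ℕ
  I : Set
  x y z : Point n
  A B C : List (Point n)

-- Arithmetic in F₃ⁿ

pattern one = suc zero
pattern two = suc (suc zero)

-₃_ : F₃ → F₃
-₃ zero = zero
-₃ one = two
-₃ two = one

+₃-comm : ∀ a b → a +₃ b ≡ b +₃ a
+₃-comm = toWitness {a? = all? λ a → all? λ b → a +₃ b ≟ b +₃ a} _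

+₃-assoc : ∀ a b c → (a +₃ b) +₃ c ≡ a +₃ (b +₃ c)
+₃-assoc = toWitness {a? = all? λ a → all? λ b → all? λ c → (a +₃ b) +₃ c ≟ a +₃ (b +₃ c)} _

+₃-inverseʳ-unique : ∀ a b → a +₃ b ≡ zero → b ≡ -₃ a
+₃-inverseʳ-unique = toWitness {a? = all? λ a → all? λ b → (a +₃ b ≟ zero) →-dec (b ≟ -₃ a)} _

+₃-triple : ∀ a → (a +₃ a) +₃ a ≡ zero
+₃-triple = toWitness {a? = all? λ a → (a +₃ a) +₃ a ≟ zero} _

⊖_ : Point n → Point n
⊖_ = Data.Vec.map -₃_

⊕-comm : (x y : Point n) → x ⊕ y ≡ y ⊕ x
⊕-comm = zipWith-comm +₃-comm

⊕-assoc : (x y z : Point n) → (x ⊕ y) ⊕ z ≡ x ⊕ (y ⊕ z)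
⊕-assoc = zipWith-assoc +₃-assoc

⊕-inverseʳ-unique : (x y : Point n) → x ⊕ y ≡ 𝟎 → y ≡ ⊖ x
⊕-inverseʳ-unique [] [] _ = refl
⊕-inverseʳ-unique (a ∷ x) (b ∷ y) eq =
  let head , tail = ∷-injective eq
  in cong₂ _∷_ (+₃-inverseʳ-unique a b head) (⊕-inverseʳ-unique x y tail)

⊕-triple : (x : Point n) → (x ⊕ x) ⊕ x ≡ 𝟎
⊕-triple [] = refl
⊕-triple (a ∷ x) = cong₂ _∷_ (+₃-triple a) (⊕-triple x)

++-zeroSum : (a a′ a″ : Point m) (b b′ b″ : Point n) →
             ((a ++ b) ⊕ (a′ ++ b′)) ⊕ (a″ ++ b″) ≡ 𝟎 →
             (a ⊕ a′) ⊕ a″ ≡ 𝟎 × (b ⊕ b′) ⊕ b″ ≡ 𝟎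
++-zeroSum [] [] [] _ _ _ eq = refl , eq
++-zeroSum (c ∷ a) (c′ ∷ a′) (c″ ∷ a″) b b′ b″ eq =
  let head , tail = ∷-injective eq
      sumA , sumB = ++-zeroSum a a′ a″ b b′ b″ tail
  in cong₂ _∷_ head sumA , sumB

-- Zero-sum-free triples, caps, and their products and unions

ZeroSumFree : List (Point n) → List (Point n) → List (Point n) → Set
ZeroSumFree A B C = ∀ {x y z} → x ∈ A → y ∈ B → z ∈ C → (x ⊕ y) ⊕ z ≢ 𝟎

-- Equivalent to IsCapSet up to duplicates (x + x + z = 0 forces z = x),
-- but in this form it is preserved by products.
Cap : List (Point n) → Set
Cap A = ∀ {x y z} → x ∈ A → y ∈ A → z ∈ A → (x ⊕ y) ⊕ z ≡ 𝟎 → x ≡ y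

cap⇒isCapSet : Unique A → Cap A → IsCapSet A
cap⇒isCapSet unique cap = unique , λ _ _ _ α∈ β∈ γ∈ α≢β _ _ → α≢β ∘ cap α∈ β∈ γ∈

zeroSumFree-swap : ZeroSumFree A B C → ZeroSumFree B A C
zeroSumFree-swap zsf {x} {y} {z} x∈ y∈ z∈ sum≡𝟎 =
  zsf y∈ x∈ z∈ (trans (cong (_⊕ z) (⊕-comm y x)) sum≡𝟎)

zeroSumFree-rotate : ZeroSumFree A B C → ZeroSumFree B C A
zeroSumFree-rotate zsf {x} {y} {z} x∈ y∈ z∈ sum≡𝟎 =
  zsf z∈ x∈ y∈ (trans (⊕-assoc z x y) (trans (⊕-comm z (x ⊕ y)) sum≡𝟎))

zeroSumFree⇒disjoint : ZeroSumFree A A B → Disjoint A B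
zeroSumFree⇒disjoint zsf (x∈A , x∈B) = zsf x∈A x∈A x∈B (⊕-triple _)

ZeroSumFreeAt : (I → List (Point n)) → I × I × I → Set
ZeroSumFreeAt S (i , j , k) = ZeroSumFree (S i) (S j) (S k)

permutations₃ : I × I × I → List (I × I × I)
permutations₃ (i , j , k) =
  (i , j , k) ∷ (i , k , j) ∷ (j , i , k) ∷ (j , k , i) ∷ (k , i , j) ∷ (k , j , i) ∷ []

zeroSumFree-permutations : (S : I → List (Point n)) {t : I × I × I} →
                           ZeroSumFreeAt S t → All (ZeroSumFreeAt S) (permutations₃ t)
zeroSumFree-permutations S zsf =
  zsf ∷ swap (rotate (rotate zsf)) ∷ swap zsf ∷ rotate zsf ∷ rotate (rotate zsf) ∷ swap (rotate zsf) ∷ []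
  where
  swap = zeroSumFree-swap
  rotate = zeroSumFree-rotate

infixr 5 _×ˢ_

_×ˢ_ : List (Point m) → List (Point n) → List (Point (m + n))
_×ˢ_ = cartesianProductWith _++_

∈-×ˢ⁻ : (A : List (Point m)) (B : List (Point n)) {x : Point (m + n)} → x ∈ A ×ˢ B →
        ∃ λ a → ∃ λ b → a ∈ A × b ∈ B × x ≡ a ++ b
∈-×ˢ⁻ = ∈-cartesianProductWith⁻ _++_

×ˢ-unique : {A : List (Point m)} {B : List (Point n)} → Unique A → Unique B → Unique (A ×ˢ B)
×ˢ-unique = cartesianProductWith⁺ _++_ (++-injective _ _)

×ˢ-cap : {A : List (Point m)} {B : List (Point n)} → Cap A → Cap B → Cap (A ×ˢ B)
×ˢ-cap {A = A} {B} capA capB x∈ y∈ z∈ sum≡𝟎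
  with ∈-×ˢ⁻ A B x∈ | ∈-×ˢ⁻ A B y∈ | ∈-×ˢ⁻ A B z∈
... | a , b , a∈ , b∈ , refl | a′ , b′ , a′∈ , b′∈ , refl | a″ , b″ , a″∈ , b″∈ , refl =
  let sumA , sumB = ++-zeroSum a a′ a″ b b′ b″ sum≡𝟎
  in cong₂ _++_ (capA a∈ a′∈ a″∈ sumA) (capB b∈ b′∈ b″∈ sumB)

×ˢ-zeroSumFreeˡ : {A A′ A″ : List (Point m)} {B B′ B″ : List (Point n)} →
                  ZeroSumFree A A′ A″ → ZeroSumFree (A ×ˢ B) (A′ ×ˢ B′) (A″ ×ˢ B″)
×ˢ-zeroSumFreeˡ {A = A} {A′} {A″} {B} {B′} {B″} zsf x∈ y∈ z∈ sum≡𝟎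
  with ∈-×ˢ⁻ A B x∈ | ∈-×ˢ⁻ A′ B′ y∈ | ∈-×ˢ⁻ A″ B″ z∈
... | a , b , a∈ , _ , refl | a′ , b′ , a′∈ , _ , refl | a″ , b″ , a″∈ , _ , refl =
  zsf a∈ a′∈ a″∈ (proj₁ (++-zeroSum a a′ a″ b b′ b″ sum≡𝟎))

×ˢ-zeroSumFreeʳ : {A A′ A″ : List (Point m)} {B B′ B″ : List (Point n)} →
                  ZeroSumFree B B′ B″ → ZeroSumFree (A ×ˢ B) (A′ ×ˢ B′) (A″ ×ˢ B″)
×ˢ-zeroSumFreeʳ {A = A} {A′} {A″} {B} {B′} {B″} zsf x∈ y∈ z∈ sum≡𝟎
  with ∈-×ˢ⁻ A B x∈ | ∈-×ˢ⁻ A′ B′ y∈ | ∈-×ˢ⁻ A″ B″ z∈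
... | a , b , _ , b∈ , refl | a′ , b′ , _ , b′∈ , refl | a″ , b″ , _ , b″∈ , refl =
  zsf b∈ b′∈ b″∈ (proj₂ (++-zeroSum a a′ a″ b b′ b″ sum≡𝟎))

Separated : (I → List (Point n)) → Set
Separated S = ∀ i j k → (i ≡ j × j ≡ k) ⊎ ZeroSumFree (S i) (S j) (S k)

concatMap-cap : {S : I → List (Point n)} {is : List I} →
                (∀ i → Cap (S i)) → Separated S → Cap (concatMap S is)
concatMap-cap {S = S} {is} caps separated x∈ y∈ z∈ =
  inBlocks (inBlock x∈) (inBlock y∈) (inBlock z∈)
  where
  inBlock : x ∈ concatMap S is → ∃ λ i → x ∈ S i
  inBlock = satisfied ∘ ∈-concatMap⁻ S {xs = is}

  inBlocks : ∃ (λ i → x ∈ S i) → ∃ (λ j → y ∈ S j) → ∃ (λ k → z ∈ S k) → (x ⊕ y) ⊕ z ≡ 𝟎 → x ≡ y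
  inBlocks (i , x∈) (j , y∈) (k , z∈) with separated i j k
  ... | inj₁ (refl , refl) = caps i x∈ y∈ z∈
  ... | inj₂ zsf = ⊥-elim ∘ zsf x∈ y∈ z∈

concatMap-unique : {S : I → List (Point n)} {is : List I} →
                   Unique is → (∀ i → Unique (S i)) → Separated S → Unique (concatMap S is)
concatMap-unique {S = S} {is} is-unique uniques separated =
  Unique-concat⁺ (All-map⁺ (All.universal uniques is)) (AllPairs-map⁺ (AllPairs.map disjoint is-unique))
  where
  disjoint : ∀ {i j} → i ≢ j → Disjoint (S i) (S j)
  disjoint {i} {j} i≢j with separated i i j
  ... | inj₁ (_ , i≡j) = ⊥-elim (i≢j i≡j)
  ... | inj₂ zsf = zeroSumFree⇒disjoint zsf

-- Deciding by evaluation

Trie : ℕ → Set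
Trie zero = Bool
Trie (suc n) = Vec (Trie n) 3

empty : ∀ n → Trie n
empty zero = false
empty (suc n) = replicate 3 (empty n)

member : Trie n → Point n → Bool
member b [] = b
member t (a ∷ x) = member (lookup t a) x

insert : Point n → Trie n → Trie n
insert [] _ = true
insert (a ∷ x) t = updateAt t a (insert x)

fromList : List (Point n) → Trie n
fromList = foldr insert (empty _)

member-insert : (x : Point n) (t : Trie n) → T (member (insert x t) x)
member-insert [] _ = _
member-insert (a ∷ x) t rewrite lookup∘updateAt a {insert x} t = member-insert x (lookup t a)

member-insert-mono : (x y : Point n) (t : Trie n) → T (member t y) → T (member (insert x t) y)
member-insert-mono [] [] _ _ = _
member-insert-mono (a ∷ x) (b ∷ y) t y∈t with a ≟ b
... | yes refl rewrite lookup∘updateAt a {insert x} t = member-insert-mono x y (lookup t a) y∈t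
... | no a≢b rewrite lookup∘updateAt′ b a {insert x} (a≢b ∘ sym) t = y∈t

fromList-complete : ∀ {xs : List (Point n)} → x ∈ xs → T (member (fromList xs) x)
fromList-complete {xs = y ∷ ys} (here refl) = member-insert y (fromList ys)
fromList-complete {x = x} {xs = y ∷ ys} (there x∈) =
  member-insert-mono y x (fromList ys) (fromList-complete x∈)

third-member : z ∈ C → (x ⊕ y) ⊕ z ≡ 𝟎 → T (member (fromList C) (⊖ (x ⊕ y)))
third-member {C = C} {x = x} {y} z∈ sum≡𝟎 =
  subst (T ∘ member (fromList C)) (⊕-inverseʳ-unique (x ⊕ y) _ sum≡𝟎) (fromList-complete z∈)

T-not⇒¬T : ∀ {b} → T (not b) → ¬ T b
T-not⇒¬T {false} _ ()

-- The trie is a separate argument so that evaluation builds it only once.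
avoidsSums : Trie n → List (Point n) → List (Point n) → Bool
avoidsSums t A B = all (λ x → all (λ y → not (member t (⊖ (x ⊕ y)))) B) A

zeroSumFree? : List (Point n) → List (Point n) → List (Point n) → Bool
zeroSumFree? A B C = avoidsSums (fromList C) A B

zeroSumFree?-sound : T (zeroSumFree? A B C) → ZeroSumFree A B C
zeroSumFree?-sound {A = A} {B} ok x∈ y∈ z∈ sum≡𝟎 =
  T-not⇒¬T (All.lookup (all⁺ _ B (All.lookup (all⁺ _ A ok) x∈)) y∈) (third-member z∈ sum≡𝟎)

zeroSumFreeAt? : (I → List (Point n)) → I × I × I → Bool
zeroSumFreeAt? S (i , j , k) = zeroSumFree? (S i) (S j) (S k)

zeroSumFreeAt?-sound : (S : I → List (Point n)) (t : I × I × I) →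
                       T (zeroSumFreeAt? S t) → ZeroSumFreeAt S t
zeroSumFreeAt?-sound S (i , j , k) = zeroSumFree?-sound {A = S i} {S j} {S k}

all-zeroSumFreeAt?⇒permutations : (S : I → List (Point n)) (ts : List (I × I × I)) →
                                    T (all (zeroSumFreeAt? S) ts) →
                                    All (ZeroSumFreeAt S) (concatMap permutations₃ ts)
all-zeroSumFreeAt?⇒permutations S ts ok =
  concat⁺ (All-map⁺ (All.map (λ {t} → zeroSumFree-permutations S ∘ zeroSumFreeAt?-sound S t)
                             (all⁺ (zeroSumFreeAt? S) ts ok)))

_≟ₚ_ : DecidableEquality (Point n)
_≟ₚ_ = Vec-≡-dec _≟_

avoidsNontrivialSums : Trie n → List (Point n) → Bool
avoidsNontrivialSums t A = all (λ x → all (λ y → does (x ≟ₚ y) ∨ not (member t (⊖ (x ⊕ y)))) A) A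

cap? : List (Point n) → Bool
cap? A = avoidsNontrivialSums (fromList A) A

cap?-sound : T (cap? A) → Cap A
cap?-sound {A = A} ok {x} {y} x∈ y∈ z∈ sum≡𝟎
  with x ≟ₚ y | All.lookup (all⁺ _ A (All.lookup (all⁺ _ A ok) x∈)) y∈
... | yes x≡y | _ = x≡y
... | no _ | y-ok = ⊥-elim (T-not⇒¬T y-ok (third-member z∈ sum≡𝟎))

-- The construction

coordinateSet : Side → List (Point 1)
coordinateSet outside = [ zero ∷ [] ]
coordinateSet inside = (one ∷ []) ∷ (two ∷ []) ∷ []

withSupport : Subset n → List (Point n)
withSupport [] = [ [] ]
withSupport (side ∷ s) = coordinateSet side ×ˢ withSupport s

coordinateSet-cap : ∀ side → Cap (coordinateSet side)
coordinateSet-cap outside = cap?-sound {A = coordinateSet outside} _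
coordinateSet-cap inside = cap?-sound {A = coordinateSet inside} _

coordinateSet-unique : ∀ side → Unique (coordinateSet side)
coordinateSet-unique outside = [] ∷ []
coordinateSet-unique inside = ((λ ()) ∷ []) ∷ [] ∷ []

withSupport-cap : (s : Subset n) → Cap (withSupport s)
withSupport-cap [] (here refl) (here refl) _ _ = refl
withSupport-cap (side ∷ s) =
  ×ˢ-cap {A = coordinateSet side} (coordinateSet-cap side) (withSupport-cap s)

withSupport-unique : (s : Subset n) → Unique (withSupport s)
withSupport-unique [] = [] ∷ []
withSupport-unique (side ∷ s) =
  ×ˢ-unique {A = coordinateSet side} (coordinateSet-unique side) (withSupport-unique s)

-- Points of F₃ⁿ written as n-digit decimal numerals, one digit per coordinate.
fromDigits : ∀ n → ℕ → Point n
fromDigits zero _ = []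
fromDigits (suc n) k = fromDigits n (k / 10) ∷ʳ (k % 10) mod 3

K-digits : Vec (List ℕ) 7
K-digits =
  ( 001201 ∷ 001202 ∷ 001210 ∷ 001220 ∷ 002101 ∷ 002102 ∷ 002110 ∷ 002120 ∷
    011200 ∷ 012100 ∷ 021200 ∷ 022100 ∷ 101200 ∷ 102100 ∷ 111111 ∷ 111112 ∷
    111121 ∷ 111211 ∷ 112111 ∷ 112211 ∷ 112212 ∷ 112221 ∷ 121111 ∷ 121121 ∷
    121122 ∷ 121221 ∷ 122121 ∷ 122211 ∷ 122221 ∷ 122222 ∷ 201200 ∷ 202100 ∷
    211111 ∷ 211112 ∷ 211122 ∷ 211212 ∷ 212112 ∷ 212211 ∷ 212212 ∷ 212222 ∷
    221112 ∷ 221121 ∷ 221122 ∷ 221222 ∷ 222122 ∷ 222212 ∷ 222221 ∷ 222222 ∷ []) ∷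
  ( 010021 ∷ 010022 ∷ 010101 ∷ 010102 ∷ 010120 ∷ 010201 ∷ 010202 ∷ 010220 ∷
    011001 ∷ 011002 ∷ 011020 ∷ 012001 ∷ 012002 ∷ 012020 ∷ 020011 ∷ 020012 ∷
    020101 ∷ 020102 ∷ 020110 ∷ 020201 ∷ 020202 ∷ 020210 ∷ 021001 ∷ 021002 ∷
    021010 ∷ 022001 ∷ 022002 ∷ 022010 ∷ 100012 ∷ 100022 ∷ 100102 ∷ 100110 ∷
    100120 ∷ 100202 ∷ 100210 ∷ 100220 ∷ 101002 ∷ 101010 ∷ 101020 ∷ 102002 ∷
    102010 ∷ 102020 ∷ 110002 ∷ 110020 ∷ 120002 ∷ 120010 ∷ 200011 ∷ 200021 ∷
    200101 ∷ 200110 ∷ 200120 ∷ 200201 ∷ 200210 ∷ 200220 ∷ 201001 ∷ 201010 ∷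
    201020 ∷ 202001 ∷ 202010 ∷ 202020 ∷ 210001 ∷ 210020 ∷ 220001 ∷ 220010 ∷ []) ∷
  ( 000111 ∷ 000112 ∷ 000121 ∷ 000122 ∷ 000211 ∷ 000212 ∷ 000221 ∷ 000222 ∷
    001011 ∷ 001012 ∷ 001021 ∷ 001022 ∷ 002011 ∷ 002012 ∷ 002021 ∷ 002022 ∷
    010101 ∷ 010102 ∷ 010201 ∷ 010202 ∷ 011001 ∷ 011002 ∷ 012001 ∷ 012002 ∷
    020101 ∷ 020102 ∷ 020201 ∷ 020202 ∷ 021001 ∷ 021002 ∷ 022001 ∷ 022002 ∷
    100110 ∷ 100120 ∷ 100210 ∷ 100220 ∷ 101010 ∷ 101020 ∷ 102010 ∷ 102020 ∷
    110100 ∷ 110200 ∷ 111000 ∷ 112000 ∷ 120100 ∷ 120200 ∷ 121000 ∷ 122000 ∷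
    200110 ∷ 200120 ∷ 200210 ∷ 200220 ∷ 201010 ∷ 201020 ∷ 202010 ∷ 202020 ∷
    210100 ∷ 210200 ∷ 211000 ∷ 212000 ∷ 220100 ∷ 220200 ∷ 221000 ∷ 222000 ∷ []) ∷
  ( 001201 ∷ 001202 ∷ 001210 ∷ 001220 ∷ 002101 ∷ 002102 ∷ 002110 ∷ 002120 ∷
    010021 ∷ 010022 ∷ 010120 ∷ 010220 ∷ 011020 ∷ 011200 ∷ 012020 ∷ 012100 ∷
    020011 ∷ 020012 ∷ 020110 ∷ 020210 ∷ 021010 ∷ 021200 ∷ 022010 ∷ 022100 ∷
    100012 ∷ 100022 ∷ 100102 ∷ 100202 ∷ 101002 ∷ 101200 ∷ 102002 ∷ 102100 ∷
    110002 ∷ 110020 ∷ 111111 ∷ 111112 ∷ 111121 ∷ 111211 ∷ 112111 ∷ 112211 ∷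
    112212 ∷ 112221 ∷ 120002 ∷ 120010 ∷ 121111 ∷ 121121 ∷ 121122 ∷ 121221 ∷
    122121 ∷ 122211 ∷ 122221 ∷ 122222 ∷ 200011 ∷ 200021 ∷ 200101 ∷ 200201 ∷
    201001 ∷ 201200 ∷ 202001 ∷ 202100 ∷ 210001 ∷ 210020 ∷ 211111 ∷ 211112 ∷
    211122 ∷ 211212 ∷ 212112 ∷ 212211 ∷ 212212 ∷ 212222 ∷ 220001 ∷ 220010 ∷
    221112 ∷ 221121 ∷ 221122 ∷ 221222 ∷ 222122 ∷ 222212 ∷ 222221 ∷ 222222 ∷ []) ∷
  ( 000111 ∷ 000112 ∷ 000121 ∷ 000122 ∷ 000211 ∷ 000212 ∷ 000221 ∷ 000222 ∷
    001011 ∷ 001012 ∷ 001021 ∷ 001022 ∷ 002011 ∷ 002012 ∷ 002021 ∷ 002022 ∷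
    010021 ∷ 010022 ∷ 010120 ∷ 010220 ∷ 011020 ∷ 012020 ∷ 020011 ∷ 020012 ∷
    020110 ∷ 020210 ∷ 021010 ∷ 022010 ∷ 100012 ∷ 100022 ∷ 100102 ∷ 100202 ∷
    101002 ∷ 102002 ∷ 110002 ∷ 110020 ∷ 110100 ∷ 110200 ∷ 111000 ∷ 112000 ∷
    120002 ∷ 120010 ∷ 120100 ∷ 120200 ∷ 121000 ∷ 122000 ∷ 200011 ∷ 200021 ∷
    200101 ∷ 200201 ∷ 201001 ∷ 202001 ∷ 210001 ∷ 210020 ∷ 210100 ∷ 210200 ∷
    211000 ∷ 212000 ∷ 220001 ∷ 220010 ∷ 220100 ∷ 220200 ∷ 221000 ∷ 222000 ∷ []) ∷
  ( 011121 ∷ 011122 ∷ 011221 ∷ 011222 ∷ 012121 ∷ 012122 ∷ 012221 ∷ 012222 ∷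
    021111 ∷ 021112 ∷ 021211 ∷ 021212 ∷ 022111 ∷ 022112 ∷ 022211 ∷ 022212 ∷
    101112 ∷ 101122 ∷ 101212 ∷ 101222 ∷ 102112 ∷ 102122 ∷ 102212 ∷ 102222 ∷
    111102 ∷ 111120 ∷ 111202 ∷ 111220 ∷ 112102 ∷ 112120 ∷ 112202 ∷ 112220 ∷
    121102 ∷ 121110 ∷ 121202 ∷ 121210 ∷ 122102 ∷ 122110 ∷ 122202 ∷ 122210 ∷
    201111 ∷ 201121 ∷ 201211 ∷ 201221 ∷ 202111 ∷ 202121 ∷ 202211 ∷ 202221 ∷
    211101 ∷ 211120 ∷ 211201 ∷ 211220 ∷ 212101 ∷ 212120 ∷ 212201 ∷ 212220 ∷
    221101 ∷ 221110 ∷ 221201 ∷ 221210 ∷ 222101 ∷ 222110 ∷ 222201 ∷ 222210 ∷ []) ∷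
  ( 011121 ∷ 011122 ∷ 011221 ∷ 011222 ∷ 012121 ∷ 012122 ∷ 012221 ∷ 012222 ∷
    021111 ∷ 021112 ∷ 021211 ∷ 021212 ∷ 022111 ∷ 022112 ∷ 022211 ∷ 022212 ∷
    101112 ∷ 101122 ∷ 101212 ∷ 101222 ∷ 102112 ∷ 102122 ∷ 102212 ∷ 102222 ∷
    111102 ∷ 111120 ∷ 111202 ∷ 111220 ∷ 112102 ∷ 112120 ∷ 112202 ∷ 112220 ∷
    121102 ∷ 121110 ∷ 121202 ∷ 121210 ∷ 122102 ∷ 122110 ∷ 122202 ∷ 122210 ∷
    201111 ∷ 201121 ∷ 201211 ∷ 201221 ∷ 202111 ∷ 202121 ∷ 202211 ∷ 202221 ∷ []) ∷ []

K : Fin 7 → List (Point 6)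
K i = map (fromDigits 6) (lookup K-digits i)

K-cap : ∀ i → Cap (K i)
K-cap i = cap?-sound (toWitness {a? = all? λ i → T? (cap? (K i))} _ i)

K-unique : ∀ i → Unique (K i)
K-unique = toWitness {a? = all? λ i → DecUnique.unique? _≟ₚ_ (K i)} _

-- Triples of the K i, up to order, admitting no zero sum: they separate every triple of
-- blocks that the supports do not.
sumFreeTriples : List (Fin 7 × Fin 7 × Fin 7)
sumFreeTriples =
  (# 0 , # 0 , # 1) ∷ (# 0 , # 0 , # 4) ∷ (# 0 , # 0 , # 5) ∷ (# 0 , # 0 , # 6) ∷ (# 0 , # 1 , # 4) ∷
  (# 1 , # 1 , # 5) ∷ (# 1 , # 1 , # 6) ∷ (# 2 , # 3 , # 3) ∷ (# 4 , # 4 , # 5) ∷ (# 4 , # 4 , # 6) ∷ []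

sumFreeOrderedTriples : List (Fin 7 × Fin 7 × Fin 7)
sumFreeOrderedTriples = concatMap permutations₃ sumFreeTriples

sumFreeOrderedTriples-sound : All (ZeroSumFreeAt K) sumFreeOrderedTriples
sumFreeOrderedTriples-sound = all-zeroSumFreeAt?⇒permutations K sumFreeTriples _

record Block : Set where
  constructor ⟨_∣_,_⟩
  field
    support : Subset 3
    left right : Fin 7

points : Block → List (Point 15)
points ⟨ s ∣ i , j ⟩ = withSupport s ×ˢ K i ×ˢ K j

points-cap : ∀ b → Cap (points b)
points-cap ⟨ s ∣ i , j ⟩ =
  ×ˢ-cap {A = withSupport s} (withSupport-cap s) (×ˢ-cap {A = K i} {K j} (K-cap i) (K-cap j))

points-unique : ∀ b → Unique (points b)
points-unique ⟨ s ∣ i , j ⟩ =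
  ×ˢ-unique {A = withSupport s} (withSupport-unique s) (×ˢ-unique {A = K i} {K j} (K-unique i) (K-unique j))

Separates : Block → Block → Block → Set
Separates ⟨ s ∣ i , j ⟩ ⟨ s′ ∣ i′ , j′ ⟩ ⟨ s″ ∣ i″ , j″ ⟩ =
  T (zeroSumFree? (withSupport s) (withSupport s′) (withSupport s″)) ⊎
  (i , i′ , i″) ∈ sumFreeOrderedTriples ⊎ (j , j′ , j″) ∈ sumFreeOrderedTriples

separates? : ∀ b c d → Dec (Separates b c d)
separates? ⟨ s ∣ i , j ⟩ ⟨ s′ ∣ i′ , j′ ⟩ ⟨ s″ ∣ i″ , j″ ⟩ =
  T? _ ⊎-dec (i , i′ , i″) ∈³? sumFreeOrderedTriples ⊎-dec (j , j′ , j″) ∈³? sumFreeOrderedTriples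
  where open DecMembership (×-≡-dec _≟_ (×-≡-dec _≟_ _≟_)) using () renaming (_∈?_ to _∈³?_)

separates⇒zeroSumFree : ∀ b c d → Separates b c d → ZeroSumFree (points b) (points c) (points d)
separates⇒zeroSumFree ⟨ s ∣ i , j ⟩ ⟨ s′ ∣ i′ , j′ ⟩ ⟨ s″ ∣ i″ , j″ ⟩ (inj₁ heads) =
  ×ˢ-zeroSumFreeˡ {A = withSupport s} {withSupport s′} {withSupport s″} (zeroSumFree?-sound heads)
separates⇒zeroSumFree ⟨ s ∣ i , j ⟩ ⟨ s′ ∣ i′ , j′ ⟩ ⟨ s″ ∣ i″ , j″ ⟩ (inj₂ (inj₁ lefts)) =
  ×ˢ-zeroSumFreeʳ {A = withSupport s} {withSupport s′} {withSupport s″}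
    (×ˢ-zeroSumFreeˡ {A = K i} {K i′} {K i″} (All.lookup sumFreeOrderedTriples-sound lefts))
separates⇒zeroSumFree ⟨ s ∣ i , j ⟩ ⟨ s′ ∣ i′ , j′ ⟩ ⟨ s″ ∣ i″ , j″ ⟩ (inj₂ (inj₂ rights)) =
  ×ˢ-zeroSumFreeʳ {A = withSupport s} {withSupport s′} {withSupport s″}
    (×ˢ-zeroSumFreeʳ {A = K i} {K i′} {K i″} (All.lookup sumFreeOrderedTriples-sound rights))

blocks : Vec Block 8
blocks =
  ⟨ inside  ∷ inside  ∷ inside  ∷ [] ∣ # 0 , # 3 ⟩ ∷
  ⟨ outside ∷ inside  ∷ inside  ∷ [] ∣ # 4 , # 3 ⟩ ∷
  ⟨ inside  ∷ outside ∷ inside  ∷ [] ∣ # 1 , # 3 ⟩ ∷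
  ⟨ inside  ∷ inside  ∷ outside ∷ [] ∣ # 4 , # 2 ⟩ ∷
  ⟨ outside ∷ inside  ∷ inside  ∷ [] ∣ # 0 , # 2 ⟩ ∷
  ⟨ outside ∷ outside ∷ inside  ∷ [] ∣ # 5 , # 3 ⟩ ∷
  ⟨ outside ∷ outside ∷ inside  ∷ [] ∣ # 1 , # 2 ⟩ ∷
  ⟨ inside  ∷ outside ∷ outside ∷ [] ∣ # 6 , # 2 ⟩ ∷ []

block : Fin 8 → List (Point 15)
block = points ∘ lookup blocks

block-separated : Separated block
block-separated i j k =
  ⊎-map₂ (separates⇒zeroSumFree (lookup blocks i) (lookup blocks j) (lookup blocks k)) (decided i j k)
  where
  decided : ∀ i j k → (i ≡ j × j ≡ k) ⊎ Separates (lookup blocks i) (lookup blocks j) (lookup blocks k)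
  decided = toWitness {a? = all? λ i → all? λ j → all? λ k →
    (i ≟ j ×-dec j ≟ k) ⊎-dec separates? (lookup blocks i) (lookup blocks j) (lookup blocks k)} _

capSet : List (Point 15)
capSet = concatMap block (allFin 8)

capSet-unique : Unique capSet
capSet-unique = concatMap-unique {S = block} {is = allFin 8}
  (allFin⁺ 8) (points-unique ∘ lookup blocks) block-separated

capSet-cap : Cap capSet
capSet-cap = concatMap-cap {S = block} {is = allFin 8} (points-cap ∘ lookup blocks) block-separated

capSet-length : length capSet ≡ 124928
capSet-length = refl

mainTheorem2 : HasCapSetOfSize 15 124928
mainTheorem2 = capSet , cap⇒isCapSet {A = capSet} capSet-unique capSet-cap , capSet-length
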